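{- Let $X$ be a string and suppose the fragment $X[i\mathinner{.\,.} j)$ has minimum CT-block-period $p$. Then for any $a,b\in[i,j]$ with $a\equiv i\pmod p$, $b\equiv j\pmod p$ and $b-a\ge 2p$, we have $X[a\mathinner{.\,.} b)\approx X[i\mathinner{.\,.} i+(b-a))$, and $X[a\mathinner{.\,.} b)$ has minimum CT-block-period $p$.
   Context: Strings are over a totally ordered alphabet; $X[i]$ is the $i$-th character (1-indexed); $X[i\mathinner{.\,.} j)$ denotes $X[i]\cdots X[j-1]$ and $X[i\mathinner{.\,.} j]$ denotes $X[i]\cdots X[j]$. The leftmost minimum of a nonempty string $S$ is $S[t]$ for the smallest index $t$ at which the minimum value occurs. The Cartesian tree $\mathsf{CT}(S)$: empty for the empty string; otherwise a root with left subtree $\mathsf{CT}(S[1\mathinner{.\,.} t-1])$ and right subtree $\mathsf{CT}(S[t+1\mathinner{.\,.} |S|])$, where $S[t]$ is the leftmost minimum. $S\approx S'$ iff $\mathsf{CT}(S)=\mathsf{CT}(S')$. A string $S[1\mathinner{.\,.} \ell]$ has CT-border-period $p\in[1,\ell]$ iff $S[1\mathinner{.\,.} \ell-p]\approx S[p+1\mathinner{.\,.} \ell]$; it has CT-block-period $p$ iff $p$ divides $\ell$, $p$ is a CT-border-period of $S$, and the leftmost minimum of $S$ is $S[1]$ or $S[\ell]$. The minimum CT-block-period is the smallest such $p$. -}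

module Defs where

open import Level using (Level)
open import Data.Nat using (ℕ; zero; suc; _+_; _∸_; _≤_)
open import Data.Nat.Divisibility using (_∣_)
open import Data.List using (List; []; _∷_; length; take; drop)
open import Data.Product using (_×_; _,_; Σ)
open import Data.Sum using (_⊎_)
open import Relation.Nullary using (yes; no)
open import Relation.Binary.Bundles using (StrictTotalOrder)
open import Relation.Binary.PropositionalEquality using (_≡_)

-- Unlabelled binary trees (shapes of Cartesian trees).
data Tree : Set where
  leaf : Tree
  node : Tree → Tree → Tree

module CT {a ℓ₁ ℓ₂ : Level} (O : StrictTotalOrder a ℓ₁ ℓ₂) where
  open StrictTotalOrder O renaming (Carrier to A)

  -- For a nonempty string x ∷ xs: (prefix before the leftmost minimum,
  -- leftmost minimum, suffix after it).
  lmSplit : A → List A → List A × A × List A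
  lmSplit x [] = [] , x , []
  lmSplit x (y ∷ ys) with lmSplit y ys
  ... | pre , m , suf with m <? x
  ...   | yes _ = x ∷ pre , m , suf
  ...   | no  _ = [] , x , y ∷ ys

  -- Cartesian tree with fuel (fuel = length suffices: both parts are shorter).
  ctF : ℕ → List A → Tree
  ctF zero    _        = leaf
  ctF (suc n) []       = leaf
  ctF (suc n) (x ∷ xs) with lmSplit x xs
  ... | pre , _ , suf = node (ctF n pre) (ctF n suf)

  CTree : List A → Tree
  CTree S = ctF (length S) S

  _≈CT_ : List A → List A → Set
  S ≈CT S' = CTree S ≡ CTree S'

  -- 1-indexed position of the leftmost minimum (0 for the empty string)
  lmPos : List A → ℕ
  lmPos []       = 0
  lmPos (x ∷ xs) with lmSplit x xs
  ... | pre , _ , _ = suc (length pre)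

  -- fragment X[i .. j) (1-indexed): X[i] ⋯ X[j-1]
  frag : List A → ℕ → ℕ → List A
  frag X i j = take (j ∸ i) (drop (i ∸ 1) X)

  CTBorderPeriod : List A → ℕ → Set
  CTBorderPeriod S p =
    (1 ≤ p) × (p ≤ length S) × (take (length S ∸ p) S ≈CT drop p S)

  CTBlockPeriod : List A → ℕ → Set
  CTBlockPeriod S p =
    (p ∣ length S) × CTBorderPeriod S p × ((lmPos S ≡ 1) ⊎ (lmPos S ≡ length S))

  MinCTBlockPeriod : List A → ℕ → Set
  MinCTBlockPeriod S p = CTBlockPeriod S p × (∀ q → CTBlockPeriod S q → p ≤ q)

{-# OPTIONS --safe #-}
module Submission where

-- Encode a string S by parent distances: entry k is the distance back to the
-- nearest earlier letter not larger than S[k], i.e. to the nearest left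
-- ancestor of k in CT(S), or 0 if there is none.  The encoding determines
-- CT(S), and the encoding of a fragment is that of S with every distance that
-- leaves the fragment replaced by 0.  If the leftmost minimum is S[1], all
-- entries after the first are nonzero, so p is a CT-border period exactly when
-- the entries from position 2 on have period p.  Hence a fragment starting at
-- a multiple of p has the same encoding as the prefix of its length, which
-- gives the CT-equivalence and the block period p; a smaller CT-border period
-- q of such a fragment of length at least 2p would, by the Fine–Wilf lemma,
-- make gcd p q a block period of the whole string.  A leftmost minimum at the
-- end is handled in the same way on the reversed string, comparing strictly.

open import Defs
open import Level using (Level)
open import Data.Empty using (⊥-elim)
open import Data.Unit using (⊤; tt)
open import Data.Nat
  using (ℕ; zero; suc; pred; _+_; _*_; _∸_; _⊓_; _%_; _/_; _≤_; _<_; _≤?_; z≤n; s≤s; s≤s⁻¹; NonZero; >-nonZero)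
open import Data.Nat.Properties
open import Data.Nat.DivMod using (m≡m%n+[m/n]*n; m%n<n)
open import Data.Nat.Divisibility using (_∣_; divides; ∣-trans; ∣m+n∣m⇒∣n; ∣m∣n⇒∣m+n; _∣0)
open import Data.Nat.GCD
  using (gcd; gcd-GCD; GCD; module GCD; gcd-comm; gcd-identityˡ; gcd-identityʳ; gcd[m,n]∣m; gcd[m,n]≤n; gcd[m,n]≢0)
open import Data.Nat.Induction using (<-wellFounded)
open import Induction.WellFounded using (Acc; acc)
open import Data.List using (List; []; _∷_; length; take; drop; _++_; reverse; _ʳ++_)
open import Data.List.Properties
  using (length-++; length-take; length-drop; take++drop≡id; take-all; take-take; take-drop; drop-drop;
         reverse-++; unfold-reverse; reverse-involutive; length-reverse; ++-assoc; ∷-injective; ++-conicalʳ)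
open import Data.List.Relation.Unary.All as All using (All; []; _∷_)
open import Data.List.Relation.Unary.All.Properties using (++⁺; ++⁻ʳ; take⁺)
open import Data.Product using (_×_; _,_; proj₁; proj₂)
open import Data.Sum using (inj₁; inj₂)
open import Function using (_∘_)
open import Function.Bundles using (_⇔_; mk⇔; Equivalence)
open import Relation.Nullary using (¬_; yes; no; ¬?)
open import Relation.Binary.Definitions using (Decidable; tri<; tri≈; tri>)
open import Relation.Binary.Bundles using (StrictTotalOrder)
open import Relation.Binary.PropositionalEquality

<pred⇔suc< : ∀ {m n} → m < pred n ⇔ suc m < n
<pred⇔suc< {m} {zero}  = mk⇔ (λ ()) (λ ())
<pred⇔suc< {m} {suc n} = mk⇔ s≤s s≤s⁻¹

<∸⇒+< : ∀ m n o → m < n ∸ o → m + o < n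
<∸⇒+< m n       zero    m<n   = subst (_< n) (sym (+-identityʳ m)) m<n
<∸⇒+< m (suc n) (suc o) m<n∸o = subst (_< suc n) (sym (+-suc m o)) (s≤s (<∸⇒+< m n o m<n∸o))

+<⇒<∸ : ∀ {m n o} → m + o < n → m < n ∸ o
+<⇒<∸ {m} = m+n≤o⇒m≤o∸n (suc m)

telescope : ∀ {x y z} → x ≤ y → y ≤ z → (y ∸ x) + (z ∸ y) ≡ z ∸ x
telescope {x} {y} {z} x≤y y≤z = +-cancelˡ-≡ x _ _ (begin
  x + ((y ∸ x) + (z ∸ y))  ≡⟨ +-assoc x (y ∸ x) (z ∸ y) ⟨
  x + (y ∸ x) + (z ∸ y)    ≡⟨ cong (_+ (z ∸ y)) (m+[n∸m]≡n x≤y) ⟩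
  y + (z ∸ y)              ≡⟨ m+[n∸m]≡n y≤z ⟩
  z                        ≡⟨ m+[n∸m]≡n (≤-trans x≤y y≤z) ⟨
  x + (z ∸ x)              ∎)
  where open ≡-Reasoning

∣m∣n⇒∣m∸n : ∀ {d m n} → d ∣ m → d ∣ n → n ≤ m → d ∣ m ∸ n
∣m∣n⇒∣m∸n {d} {m} {n} d∣m d∣n n≤m =
  ∣m+n∣m⇒∣n (subst (d ∣_) (sym (m+[n∸m]≡n n≤m)) d∣m) d∣n

gcd[m,n∸m]≡gcd[m,n] : ∀ {m n} → m ≤ n → gcd m (n ∸ m) ≡ gcd m n
gcd[m,n∸m]≡gcd[m,n] {m} {n} m≤n = GCD.unique
  (subst (λ k → GCD m k (gcd m (n ∸ m))) (m+[n∸m]≡n m≤n) (GCD.step (gcd-GCD m (n ∸ m))))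
  (gcd-GCD m n)

gcd[m∸n,n]≡gcd[m,n] : ∀ {m n} → n ≤ m → gcd (m ∸ n) n ≡ gcd m n
gcd[m∸n,n]≡gcd[m,n] {m} {n} n≤m =
  trans (gcd-comm (m ∸ n) n) (trans (gcd[m,n∸m]≡gcd[m,n] n≤m) (gcd-comm n m))

module _ {a} {A : Set a} where

  slice : ℕ → ℕ → List A → List A
  slice s m Y = take m (drop s Y)

  length-slice : ∀ s m (Y : List A) → s + m ≤ length Y → length (slice s m Y) ≡ m
  length-slice s m Y s+m≤ = begin
    length (take m (drop s Y))  ≡⟨ length-take m (drop s Y) ⟩
    m ⊓ length (drop s Y)       ≡⟨ cong (m ⊓_) (length-drop s Y) ⟩
    m ⊓ (length Y ∸ s)          ≡⟨ m≤n⇒m⊓n≡m m≤ℓ∸s ⟩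
    m                           ∎
    where
    open ≡-Reasoning
    m≤ℓ∸s = m+n≤o⇒m≤o∸n m (subst (_≤ length Y) (+-comm s m) s+m≤)

  slice-suffix : ∀ s (Y : List A) → slice s (length Y ∸ s) Y ≡ drop s Y
  slice-suffix s Y = take-all (length Y ∸ s) (drop s Y) (≤-reflexive (length-drop s Y))

  slice-slice : ∀ r n s m (Y : List A) → s + m ≤ n → slice s m (slice r n Y) ≡ slice (r + s) m Y
  slice-slice r n s m Y s+m≤n = begin
    take m (drop s (take n (drop r Y)))              ≡⟨ cong (λ k → take m (drop s (take k (drop r Y))))
                                                                (m+[n∸m]≡n s≤n) ⟨
    take m (drop s (take (s + (n ∸ s)) (drop r Y)))  ≡⟨ cong (take m) (take-drop (n ∸ s) s (drop r Y)) ⟨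
    take m (take (n ∸ s) (drop s (drop r Y)))        ≡⟨ take-take m (n ∸ s) _ ⟩
    take (m ⊓ (n ∸ s)) (drop s (drop r Y))           ≡⟨ cong₂ take (m≤n⇒m⊓n≡m m≤n∸s) (drop-drop r s Y) ⟩
    take m (drop (r + s) Y)                          ∎
    where
    open ≡-Reasoning
    s≤n = ≤-trans (m≤m+n s m) s+m≤n
    m≤n∸s = m+n≤o⇒m≤o∸n m (subst (_≤ n) (+-comm s m) s+m≤n)

  take-length-++ : ∀ (P Q : List A) → take (length P) (P ++ Q) ≡ P
  take-length-++ []      Q = refl
  take-length-++ (x ∷ P) Q = cong (x ∷_) (take-length-++ P Q)

  drop-length-++ : ∀ (P Q : List A) → drop (length P) (P ++ Q) ≡ Q
  drop-length-++ []      Q = refl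
  drop-length-++ (x ∷ P) Q = drop-length-++ P Q

  reverse-slice : ∀ s m (Y : List A) → s + m ≤ length Y →
                  reverse (slice s m Y) ≡ slice (length Y ∸ (s + m)) m (reverse Y)
  reverse-slice s m Y s+m≤ = begin
    reverse M                                            ≡⟨ take-length-++ (reverse M) (reverse P) ⟨
    take (length (reverse M)) (reverse M ++ reverse P)   ≡⟨ cong₂ take |M| (sym (drop-length-++ (reverse Q) _)) ⟩
    take m (drop (length (reverse Q)) (reverse Q ++ reverse M ++ reverse P))
                                                         ≡⟨ cong₂ (λ k Z → take m (drop k Z)) |Q| reverse-PMQ ⟩
    take m (drop (length Y ∸ (s + m)) (reverse Y))       ∎
    where
    open ≡-Reasoning
    P = take s Y
    M = slice s m Y
    Q = drop m (drop s Y)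
    |M| : length (reverse M) ≡ m
    |M| = trans (length-reverse M) (length-slice s m Y s+m≤)
    |Q| : length (reverse Q) ≡ length Y ∸ (s + m)
    |Q| = begin
      length (reverse Q)       ≡⟨ length-reverse Q ⟩
      length (drop m (drop s Y)) ≡⟨ cong length (drop-drop s m Y) ⟩
      length (drop (s + m) Y)  ≡⟨ length-drop (s + m) Y ⟩
      length Y ∸ (s + m)       ∎
    reverse-PMQ : reverse Q ++ reverse M ++ reverse P ≡ reverse Y
    reverse-PMQ = begin
      reverse Q ++ reverse M ++ reverse P    ≡⟨ ++-assoc (reverse Q) (reverse M) (reverse P) ⟨
      (reverse Q ++ reverse M) ++ reverse P  ≡⟨ cong (_++ reverse P) (reverse-++ M Q) ⟨
      reverse (M ++ Q) ++ reverse P          ≡⟨ reverse-++ P (M ++ Q) ⟨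
      reverse (P ++ M ++ Q)                  ≡⟨ cong (λ Z → reverse (P ++ Z)) (take++drop≡id m (drop s Y)) ⟩
      reverse (P ++ drop s Y)                ≡⟨ cong reverse (take++drop≡id s Y) ⟩
      reverse Y                              ∎

  reverse-take-drop : ∀ n (Y : List A) → reverse Y ≡ reverse (drop n Y) ++ reverse (take n Y)
  reverse-take-drop n Y = trans (cong reverse (sym (take++drop≡id n Y))) (reverse-++ (take n Y) (drop n Y))

  length-reverse-drop : ∀ n (Y : List A) → length (reverse (drop n Y)) ≡ length Y ∸ n
  length-reverse-drop n Y = trans (length-reverse (drop n Y)) (length-drop n Y)

  reverse-drop : ∀ n (Y : List A) → reverse (drop n Y) ≡ take (length Y ∸ n) (reverse Y)
  reverse-drop n Y = sym (begin
    take (length Y ∸ n) (reverse Y)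
      ≡⟨ cong₂ take (sym (length-reverse-drop n Y)) (reverse-take-drop n Y) ⟩
    take (length (reverse (drop n Y))) (reverse (drop n Y) ++ reverse (take n Y))
      ≡⟨ take-length-++ (reverse (drop n Y)) _ ⟩
    reverse (drop n Y)
      ∎)
    where open ≡-Reasoning

  reverse-take : ∀ n (Y : List A) → reverse (take n Y) ≡ drop (length Y ∸ n) (reverse Y)
  reverse-take n Y = sym (begin
    drop (length Y ∸ n) (reverse Y)
      ≡⟨ cong₂ drop (sym (length-reverse-drop n Y)) (reverse-take-drop n Y) ⟩
    drop (length (reverse (drop n Y))) (reverse (drop n Y) ++ reverse (take n Y))
      ≡⟨ drop-length-++ (reverse (drop n Y)) _ ⟩
    reverse (take n Y)
      ∎)
    where open ≡-Reasoning

  reverse-++-∷ : ∀ P (m : A) Q → reverse (P ++ m ∷ Q) ≡ reverse Q ++ m ∷ reverse P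
  reverse-++-∷ P m Q = begin
    reverse (P ++ m ∷ Q)               ≡⟨ reverse-++ P (m ∷ Q) ⟩
    reverse (m ∷ Q) ++ reverse P       ≡⟨ cong (_++ reverse P) (unfold-reverse m Q) ⟩
    (reverse Q ++ m ∷ []) ++ reverse P ≡⟨ ++-assoc (reverse Q) (m ∷ []) (reverse P) ⟩
    reverse Q ++ m ∷ reverse P         ∎
    where open ≡-Reasoning

  All-ʳ++ : ∀ {p} {Pr : A → Set p} {xs ys} → All Pr xs → All Pr ys → All Pr (xs ʳ++ ys)
  All-ʳ++ []         ys = ys
  All-ʳ++ (px ∷ pxs) ys = All-ʳ++ pxs (px ∷ ys)

-- Indexing that returns 0 past the end.
infixl 9 _!_

_!_ : List ℕ → ℕ → ℕ
[]      ! _     = 0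
(v ∷ _) ! zero  = v
(_ ∷ W) ! suc k = W ! k

!-take : ∀ {n k} W → k < n → take n W ! k ≡ W ! k
!-take {suc n} []      _         = refl
!-take {suc n} {zero}  (v ∷ W) _         = refl
!-take {suc n} {suc k} (v ∷ W) (s≤s k<n) = !-take W k<n

!-drop : ∀ s W k → drop s W ! k ≡ W ! (s + k)
!-drop zero    W       k = refl
!-drop (suc s) []      k = refl
!-drop (suc s) (_ ∷ W) k = !-drop s W k

!-ext : ∀ U V → length U ≡ length V → (∀ k → k < length U → U ! k ≡ V ! k) → U ≡ V
!-ext []      []      _  _  = refl
!-ext (u ∷ U) (v ∷ V) eq pt =
  cong₂ _∷_ (pt 0 (s≤s z≤n)) (!-ext U V (suc-injective eq) (λ k k< → pt (suc k) (s≤s k<)))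

All-! : ∀ {p} {P : ℕ → Set p} {W k} → All P W → k < length W → P (W ! k)
All-! {k = zero}  (pw ∷ _)   _        = pw
All-! {k = suc k} (_  ∷ pws) (s≤s k<) = All-! pws k<

-- A parent at distance v stays inside a window that starts k positions
-- earlier iff v ≤ k; otherwise the window sees no parent (0).
clip : ℕ → ℕ → ℕ
clip k v with v ≤? k
... | yes _ = v
... | no  _ = 0

clip-≤ : ∀ {k v} → v ≤ k → clip k v ≡ v
clip-≤ {k} {v} v≤k with v ≤? k
... | yes _   = refl
... | no  v≰k = ⊥-elim (v≰k v≤k)

clip-zero : ∀ v → clip 0 v ≡ 0
clip-zero zero    = refl
clip-zero (suc v) = refl

clip-nonzero : ∀ {k u v} → v ≢ 0 → clip k u ≡ v → u ≡ v
clip-nonzero {k} {u} v≢0 eq with u ≤? k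
... | yes _ = eq
... | no  _ = ⊥-elim (v≢0 (sym eq))

clipFrom : ℕ → List ℕ → List ℕ
clipFrom c []      = []
clipFrom c (v ∷ W) = clip c v ∷ clipFrom (suc c) W

!-clipFrom : ∀ c W k → clipFrom c W ! k ≡ clip (c + k) (W ! k)
!-clipFrom c []      k       = refl
!-clipFrom c (v ∷ W) zero    = cong (λ n → clip n v) (sym (+-identityʳ c))
!-clipFrom c (v ∷ W) (suc k) = trans (!-clipFrom (suc c) W k) (cong (λ n → clip n (W ! k)) (sym (+-suc c k)))

take-clipFrom : ∀ m c W → take m (clipFrom c W) ≡ clipFrom c (take m W)
take-clipFrom zero    c W       = refl
take-clipFrom (suc m) c []      = refl
take-clipFrom (suc m) c (v ∷ W) = cong (clip c v ∷_) (take-clipFrom m (suc c) W)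

ZeroFree : List ℕ → Set
ZeroFree = All (_≢ 0)

-- Every element but the first has a parent: the first element is a minimum.
Anchored : List ℕ → Set
Anchored []      = ⊤
Anchored (_ ∷ W) = ZeroFree W

anchored-! : ∀ {W k} → Anchored W → 1 ≤ k → k < length W → W ! k ≢ 0
anchored-! {_ ∷ W} {suc k} zf _ (s≤s k<) = All-! zf k<

anchored-take : ∀ m {W} → Anchored W → Anchored (take m W)
anchored-take zero    {W}     _  = tt
anchored-take (suc m) {[]}    _  = tt
anchored-take (suc m) {_ ∷ W} zf = take⁺ m zf

infixl 6 _or_

_or_ : ℕ → ℕ → ℕ
zero  or d = d
suc v or _ = suc v

-- For the serialisation of a right subtree whose root lies c + 1 positions
-- before it: entries with no left ancestor inside the subtree point to that root.
attach : ℕ → List ℕ → List ℕ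
attach c []      = []
attach c (v ∷ W) = v or suc c ∷ attach (suc c) W

attach-zeroFree : ∀ c W → ZeroFree (attach c W)
attach-zeroFree c []            = []
attach-zeroFree c (zero  ∷ W) = (λ ()) ∷ attach-zeroFree (suc c) W
attach-zeroFree c (suc v ∷ W) = (λ ()) ∷ attach-zeroFree (suc c) W

anchored-split⇔ : ∀ U V → Anchored (U ++ 0 ∷ attach 0 V) ⇔ length U ≡ 0
anchored-split⇔ U V = mk⇔ (to U) (from U)
  where
  to : ∀ U → Anchored (U ++ 0 ∷ attach 0 V) → length U ≡ 0
  to []      _  = refl
  to (_ ∷ U) zf with () ← All.head (++⁻ʳ U zf) refl
  from : ∀ U → length U ≡ 0 → Anchored (U ++ 0 ∷ attach 0 V)
  from [] _ = attach-zeroFree 0 V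

last-zero-split-unique : ∀ {U U′ V V′} → ZeroFree V → ZeroFree V′ →
                         U ++ 0 ∷ V ≡ U′ ++ 0 ∷ V′ → U ≡ U′ × V ≡ V′
last-zero-split-unique {[]}    {[]}     _  _   refl = refl , refl
last-zero-split-unique {[]}    {_ ∷ U′} zf _   refl with () ← All.head (++⁻ʳ U′ zf) refl
last-zero-split-unique {_ ∷ U} {[]}     _  zf′ refl with () ← All.head (++⁻ʳ U zf′) refl
last-zero-split-unique {_ ∷ U} {_ ∷ U′} zf zf′ eq
  with refl , eq′ ← ∷-injective eq
  with refl , refl ← last-zero-split-unique {U} {U′} zf zf′ eq′ = refl , refl

Bounded : ℕ → List ℕ → Set
Bounded c []      = ⊤
Bounded c (v ∷ W) = v ≤ c × Bounded (suc c) W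

!-bounded : ∀ {c} W k → Bounded c W → W ! k ≤ c + k
!-bounded {c} []      k       _           = z≤n
!-bounded {c} (v ∷ W) zero    (v≤c , _)   = ≤-trans v≤c (m≤m+n c 0)
!-bounded {c} (v ∷ W) (suc k) (_ , bound) = subst (W ! k ≤_) (sym (+-suc c k)) (!-bounded W k bound)

Bounded-++ : ∀ {c} U {V} → Bounded c U → Bounded (c + length U) V → Bounded c (U ++ V)
Bounded-++ {c} []      {V} _           bV = subst (λ n → Bounded n V) (+-identityʳ c) bV
Bounded-++ {c} (u ∷ U) {V} (u≤c , bU) bV = u≤c , Bounded-++ U bU (subst (λ n → Bounded n V) (+-suc c (length U)) bV)

Bounded-attach : ∀ {c d} W → Bounded d W → d < c → Bounded c (attach d W)
Bounded-attach []            _          _   = tt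
Bounded-attach (zero  ∷ W) (_ , bW)   d<c = d<c , Bounded-attach W bW (s≤s d<c)
Bounded-attach (suc v ∷ W) (v≤d , bW) d<c = ≤-trans v≤d (<⇒≤ d<c) , Bounded-attach W bW (s≤s d<c)

attach-injective : ∀ {c} U V → Bounded c U → Bounded c V → attach c U ≡ attach c V → U ≡ V
attach-injective []      []      _ _ _ = refl
attach-injective (u ∷ U) (v ∷ V) (u≤c , bU) (v≤c , bV) eq with ∷-injective eq
... | head≡ , tail≡ = cong₂ _∷_ (or-injective u v u≤c v≤c head≡) (attach-injective U V bU bV tail≡)
  where
  or-injective : ∀ {c} u v → u ≤ c → v ≤ c → u or suc c ≡ v or suc c → u ≡ v
  or-injective zero    zero    _   _   _  = refl
  or-injective zero    (suc v) _   v≤c eq = ⊥-elim (<-irrefl (sym (suc-injective eq)) v≤c)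
  or-injective (suc u) zero    u≤c _   eq = ⊥-elim (<-irrefl (suc-injective eq) u≤c)
  or-injective (suc u) (suc v) _   _   eq = eq

-- The node at in-order position k is recorded by the distance back to its
-- nearest ancestor on the left (0 if there is none).
serialise : Tree → List ℕ
serialise leaf       = []
serialise (node l r) = serialise l ++ 0 ∷ attach 0 (serialise r)

serialise-bounded : ∀ t → Bounded 0 (serialise t)
serialise-bounded leaf       = tt
serialise-bounded (node l r) =
  Bounded-++ (serialise l) (serialise-bounded l) (z≤n , Bounded-attach (serialise r) (serialise-bounded r) (s≤s z≤n))

serialise-injective : ∀ t t′ → serialise t ≡ serialise t′ → t ≡ t′
serialise-injective leaf       leaf         _  = refl
serialise-injective leaf       (node l′ r′) eq with () ← ++-conicalʳ (serialise l′) _ (sym eq)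
serialise-injective (node l r) leaf         eq with () ← ++-conicalʳ (serialise l) _ eq
serialise-injective (node l r) (node l′ r′) eq
  with l≡ , r≡ ← last-zero-split-unique (attach-zeroFree 0 (serialise r)) (attach-zeroFree 0 (serialise r′)) eq =
  cong₂ node (serialise-injective l l′ l≡)
             (serialise-injective r r′ (attach-injective _ _ (serialise-bounded r) (serialise-bounded r′) r≡))

mirror : Tree → Tree
mirror leaf       = leaf
mirror (node l r) = node (mirror r) (mirror l)

mirror-involutive : ∀ t → mirror (mirror t) ≡ t
mirror-involutive leaf       = refl
mirror-involutive (node l r) = cong₂ node (mirror-involutive l) (mirror-involutive r)

module _ {b} {B : Set b} where

  Periodic : (ℕ → B) → ℕ → ℕ → Set b
  Periodic f n t = ∀ k → k + t < n → f (k + t) ≡ f k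

  periodic-restrict : ∀ {f n n′ t} → n′ ≤ n → Periodic f n t → Periodic f n′ t
  periodic-restrict n′≤n per k k+t<n′ = per k (<-≤-trans k+t<n′ n′≤n)

  periodic-cong : ∀ {f g n t} → (∀ k → k < n → f k ≡ g k) → Periodic f n t → Periodic g n t
  periodic-cong {f} {g} {n} {t} f≗g per k k+t<n = begin
    g (k + t)  ≡⟨ f≗g (k + t) k+t<n ⟨
    f (k + t)  ≡⟨ per k k+t<n ⟩
    f k        ≡⟨ f≗g k (≤-<-trans (m≤m+n k t) k+t<n) ⟩
    g k        ∎
    where open ≡-Reasoning

  periodic-∸ : ∀ {f n p q} → q ≤ p → p + q ≤ n → Periodic f n p → Periodic f n q → Periodic f n (p ∸ q)
  periodic-∸ {f} {n} {p} {q} q≤p p+q≤n per-p per-q k k+[p∸q]<n with k + p <? n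
  ... | yes k+p<n = begin
    f (k + (p ∸ q))      ≡⟨ per-q (k + (p ∸ q)) (subst (_< n) (sym shift) k+p<n) ⟨
    f (k + (p ∸ q) + q)  ≡⟨ cong f shift ⟩
    f (k + p)            ≡⟨ per-p k k+p<n ⟩
    f k                  ∎
    where
    open ≡-Reasoning
    shift : k + (p ∸ q) + q ≡ k + p
    shift = trans (+-assoc k (p ∸ q) q) (cong (k +_) (m∸n+n≡m q≤p))
  ... | no k+p≮n = begin
    f (k + (p ∸ q))  ≡⟨ cong f shift ⟩
    f (k₀ + p)       ≡⟨ per-p k₀ (subst (_< n) shift k+[p∸q]<n) ⟩
    f k₀             ≡⟨ per-q k₀ (subst (_< n) (sym k₀+q≡k) (≤-<-trans (m≤m+n k (p ∸ q)) k+[p∸q]<n)) ⟨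
    f (k₀ + q)       ≡⟨ cong f k₀+q≡k ⟩
    f k              ∎
    where
    open ≡-Reasoning
    q≤k : q ≤ k
    q≤k = +-cancelʳ-≤ p q k (≤-trans (subst (_≤ n) (+-comm p q) p+q≤n) (≮⇒≥ k+p≮n))
    k₀ = k ∸ q
    k₀+q≡k : k₀ + q ≡ k
    k₀+q≡k = m∸n+n≡m q≤k
    shift : k + (p ∸ q) ≡ k₀ + p
    shift = trans (cong (_+ (p ∸ q)) (sym k₀+q≡k))
                  (trans (+-assoc k₀ q (p ∸ q)) (cong (k₀ +_) (m+[n∸m]≡n q≤p)))

  periodic-gcd : ∀ {f n p q} → p + q ≤ n → Periodic f n p → Periodic f n q → Periodic f n (gcd p q)
  periodic-gcd {f} {n} = euclid (<-wellFounded _)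
    where
    euclid : ∀ {p q} → Acc _<_ (p + q) → p + q ≤ n → Periodic f n p → Periodic f n q → Periodic f n (gcd p q)
    euclid {zero}  {q}    _ _ _     per-q = subst (Periodic f n) (sym (gcd-identityˡ q)) per-q
    euclid {suc p} {zero} _ _ per-p _     = subst (Periodic f n) (sym (gcd-identityʳ (suc p))) per-p
    euclid {p@(suc _)} {q@(suc _)} (acc rec) p+q≤n per-p per-q with ≤-total p q
    ... | inj₁ p≤q = subst (Periodic f n) (gcd[m,n∸m]≡gcd[m,n] p≤q)
      (euclid (rec (subst (_< p + q) (sym (m+[n∸m]≡n p≤q)) (m<n+m q (s≤s z≤n))))
              (subst (_≤ n) (sym (m+[n∸m]≡n p≤q)) (≤-trans (m≤n+m q p) p+q≤n))
              per-p (periodic-∸ p≤q (subst (_≤ n) (+-comm p q) p+q≤n) per-q per-p))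
    ... | inj₂ q≤p = subst (Periodic f n) (gcd[m∸n,n]≡gcd[m,n] q≤p)
      (euclid (rec (subst (_< p + q) (sym (m∸n+n≡m q≤p)) (m<m+n p (s≤s z≤n))))
              (subst (_≤ n) (sym (m∸n+n≡m q≤p)) (≤-trans (m≤m+n p q) p+q≤n))
              (periodic-∸ q≤p p+q≤n per-p per-q) per-q)

  periodic-* : ∀ {f n p} → Periodic f n p → ∀ c k → k + c * p < n → f (k + c * p) ≡ f k
  periodic-* {f} {n} {p} per zero    k _          = cong f (+-identityʳ k)
  periodic-* {f} {n} {p} per (suc c) k k+[p+cp]<n = begin
    f (k + (p + c * p))  ≡⟨ cong f regroup ⟩
    f (k + c * p + p)    ≡⟨ per (k + c * p) k+cp+p<n ⟩
    f (k + c * p)        ≡⟨ periodic-* per c k (≤-<-trans (m≤m+n (k + c * p) p) k+cp+p<n) ⟩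
    f k                  ∎
    where
    open ≡-Reasoning
    regroup : k + (p + c * p) ≡ k + c * p + p
    regroup = trans (cong (k +_) (+-comm p (c * p))) (sym (+-assoc k (c * p) p))
    k+cp+p<n = subst (_< n) regroup k+[p+cp]<n

  periodic-∣ : ∀ {f n p d} → Periodic f n p → p ∣ d → ∀ k → k + d < n → f (k + d) ≡ f k
  periodic-∣ per (divides c refl) = periodic-* per c

  periodic-extend : ∀ {f n N p g} .{{_ : NonZero p}} →
                    Periodic f n p → Periodic f N g → p + g ≤ N → Periodic f n g
  periodic-extend {f} {n} {N} {p} {g} per-p per-g p+g≤N k k+g<n = begin
    f (k + g)          ≡⟨ cong f regroup ⟩
    f (r + g + c * p)  ≡⟨ periodic-* per-p c (r + g) (subst (_< n) regroup k+g<n) ⟩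
    f (r + g)          ≡⟨ per-g r (<-≤-trans (+-monoˡ-< g (m%n<n k p)) p+g≤N) ⟩
    f r                ≡⟨ periodic-* per-p c r (subst (_< n) k≡r+cp (≤-<-trans (m≤m+n k g) k+g<n)) ⟨
    f (r + c * p)      ≡⟨ cong f k≡r+cp ⟨
    f k                ∎
    where
    open ≡-Reasoning
    r = k % p
    c = k / p
    k≡r+cp : k ≡ r + c * p
    k≡r+cp = m≡m%n+[m/n]*n k p
    regroup : k + g ≡ r + g + c * p
    regroup = begin
      k + g            ≡⟨ cong (_+ g) k≡r+cp ⟩
      r + c * p + g    ≡⟨ +-assoc r (c * p) g ⟩
      r + (c * p + g)  ≡⟨ cong (r +_) (+-comm (c * p) g) ⟩
      r + (g + c * p)  ≡⟨ +-assoc r g (c * p) ⟨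
      r + g + c * p    ∎

bump : ℕ → ℕ
bump zero    = zero
bump (suc v) = suc (suc v)

bump-clip : ∀ n v → bump (clip n v) ≡ clip (suc n) (bump v)
bump-clip n zero    = refl
bump-clip n (suc v) with suc v ≤? n | suc (suc v) ≤? suc n
... | yes _   | yes _   = refl
... | no  _   | no  _   = refl
... | yes v<n | no  v≮n = ⊥-elim (v≮n (s≤s v<n))
... | no  v≮n | yes v<n = ⊥-elim (v≮n (s≤s⁻¹ v<n))

bump-or : ∀ v c → bump (v or suc c) ≡ bump v or suc (suc c)
bump-or zero    c = refl
bump-or (suc v) c = refl

module ParentDistance {a r} {A : Set a} {R : A → A → Set r} (R? : Decidable R) where

  -- The earlier elements are listed nearest first; 0 means that none of them
  -- is related to x.
  distance : List A → A → ℕ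
  distance []       x = 0
  distance (y ∷ ys) x with R? y x
  ... | yes _ = 1
  ... | no  _ = bump (distance ys x)

  encodeFrom : List A → List A → List ℕ
  encodeFrom ys []       = []
  encodeFrom ys (x ∷ xs) = distance ys x ∷ encodeFrom (x ∷ ys) xs

  encode : List A → List ℕ
  encode = encodeFrom []

  length-encodeFrom : ∀ ys xs → length (encodeFrom ys xs) ≡ length xs
  length-encodeFrom ys []       = refl
  length-encodeFrom ys (x ∷ xs) = cong suc (length-encodeFrom (x ∷ ys) xs)

  encodeFrom-++ : ∀ ys P Q → encodeFrom ys (P ++ Q) ≡ encodeFrom ys P ++ encodeFrom (P ʳ++ ys) Q
  encodeFrom-++ ys []      Q = refl
  encodeFrom-++ ys (x ∷ P) Q = cong (distance ys x ∷_) (encodeFrom-++ (x ∷ ys) P Q)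

  encodeFrom-take : ∀ ys m xs → encodeFrom ys (take m xs) ≡ take m (encodeFrom ys xs)
  encodeFrom-take ys zero    xs       = refl
  encodeFrom-take ys (suc m) []       = refl
  encodeFrom-take ys (suc m) (x ∷ xs) = cong (distance ys x ∷_) (encodeFrom-take (x ∷ ys) m xs)

  distance-clip : ∀ ys zs x → distance ys x ≡ clip (length ys) (distance (ys ++ zs) x)
  distance-clip []       zs x = sym (clip-zero (distance zs x))
  distance-clip (y ∷ ys) zs x with R? y x
  ... | yes _ = refl
  ... | no  _ = trans (cong bump (distance-clip ys zs x)) (bump-clip (length ys) (distance (ys ++ zs) x))

  encodeFrom-clip : ∀ ys zs xs → encodeFrom ys xs ≡ clipFrom (length ys) (encodeFrom (ys ++ zs) xs)
  encodeFrom-clip ys zs []       = refl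
  encodeFrom-clip ys zs (x ∷ xs) = cong₂ _∷_ (distance-clip ys zs x) (encodeFrom-clip (x ∷ ys) zs xs)

  encode-drop : ∀ s zs xs → encode (drop s xs) ≡ clipFrom 0 (drop s (encodeFrom zs xs))
  encode-drop zero    zs xs       = encodeFrom-clip [] zs xs
  encode-drop (suc s) zs []       = refl
  encode-drop (suc s) zs (x ∷ xs) = encode-drop s (x ∷ zs) xs

  encode-slice : ∀ s m xs → encode (slice s m xs) ≡ clipFrom 0 (slice s m (encode xs))
  encode-slice s m xs = begin
    encode (take m (drop s xs))                 ≡⟨ encodeFrom-take [] m (drop s xs) ⟩
    take m (encode (drop s xs))                 ≡⟨ cong (take m) (encode-drop s [] xs) ⟩
    take m (clipFrom 0 (drop s (encode xs)))    ≡⟨ take-clipFrom m 0 (drop s (encode xs)) ⟩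
    clipFrom 0 (take m (drop s (encode xs)))    ∎
    where open ≡-Reasoning

  distance-none : ∀ {ys x} → All (λ y → ¬ R y x) ys → distance ys x ≡ 0
  distance-none {x = x} []                   = refl
  distance-none {x = x} (_∷_ {y} ¬Ryx ¬Rysx) with R? y x
  ... | yes Ryx = ⊥-elim (¬Ryx Ryx)
  ... | no  _   = cong bump (distance-none ¬Rysx)

  distance-attach : ∀ {m x} ys zs → R m x → distance (ys ++ m ∷ zs) x ≡ distance ys x or suc (length ys)
  distance-attach {m} {x} [] zs Rmx with R? m x
  ... | yes _    = refl
  ... | no  ¬Rmx = ⊥-elim (¬Rmx Rmx)
  distance-attach {m} {x} (y ∷ ys) zs Rmx with R? y x
  ... | yes _ = refl
  ... | no  _ = trans (cong bump (distance-attach ys zs Rmx)) (bump-or (distance ys x) (length ys))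

  encodeFrom-attach : ∀ {m} ys zs xs → All (R m) xs →
                      encodeFrom (ys ++ m ∷ zs) xs ≡ attach (length ys) (encodeFrom ys xs)
  encodeFrom-attach ys zs []       []            = refl
  encodeFrom-attach ys zs (x ∷ xs) (Rmx ∷ Rmxs) =
    cong₂ _∷_ (distance-attach ys zs Rmx) (encodeFrom-attach (x ∷ ys) zs xs Rmxs)

  encode-split : ∀ {P m Q} → All (λ y → ¬ R y m) P → All (R m) Q →
                 encode (P ++ m ∷ Q) ≡ encode P ++ 0 ∷ attach 0 (encode Q)
  encode-split {P} {m} {Q} ¬RPm RmQ = begin
    encode (P ++ m ∷ Q)                               ≡⟨ encodeFrom-++ [] P (m ∷ Q) ⟩
    encode P ++ encodeFrom (P ʳ++ []) (m ∷ Q)         ≡⟨ cong (encode P ++_) (cong₂ _∷_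
                                                           (distance-none (All-ʳ++ ¬RPm []))
                                                           (encodeFrom-attach [] (P ʳ++ []) Q RmQ)) ⟩
    encode P ++ 0 ∷ attach 0 (encode Q)               ∎
    where open ≡-Reasoning

-- Entry 0 of an encoding is always 0, so periods are measured from entry 1 on.
shifted : List ℕ → ℕ → ℕ
shifted W k = W ! suc k

-- The argument uses only these properties of an encoding, so it serves both for
-- CT(S) itself and for the mirrored tree read on the reversed string.
module AnchoredPeriods
  {a r} {A : Set a} (_≋_ : List A → List A → Set r) (encode : List A → List ℕ)
  (≋⇔≡ : ∀ {Y Y′} → Y ≋ Y′ ⇔ encode Y ≡ encode Y′)
  (length-encode : ∀ Y → length (encode Y) ≡ length Y)
  (encode-bounded : ∀ Y k → encode Y ! k ≤ k)
  (encode-slice : ∀ s m Y → encode (slice s m Y) ≡ clipFrom 0 (slice s m (encode Y)))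
  where

  BorderPeriod : List A → ℕ → Set r
  BorderPeriod S p = (1 ≤ p) × (p ≤ length S) × (take (length S ∸ p) S ≋ drop p S)

  AnchoredBlockPeriod : List A → ℕ → Set r
  AnchoredBlockPeriod S p = Anchored (encode S) × (p ∣ length S) × BorderPeriod S p

  MinAnchoredBlockPeriod : List A → ℕ → Set r
  MinAnchoredBlockPeriod S p = AnchoredBlockPeriod S p × (∀ q → q ∣ length S → BorderPeriod S q → p ≤ q)

  !-encode-slice : ∀ s m Y {k} → k < m → encode (slice s m Y) ! k ≡ clip k (encode Y ! (s + k))
  !-encode-slice s m Y {k} k<m = begin
    encode (slice s m Y) ! k                        ≡⟨ cong (_! k) (encode-slice s m Y) ⟩
    clipFrom 0 (take m (drop s (encode Y))) ! k     ≡⟨ !-clipFrom 0 (take m (drop s (encode Y))) k ⟩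
    clip k (take m (drop s (encode Y)) ! k)         ≡⟨ cong (clip k) (!-take (drop s (encode Y)) k<m) ⟩
    clip k (drop s (encode Y) ! k)                  ≡⟨ cong (clip k) (!-drop s (encode Y) k) ⟩
    clip k (encode Y ! (s + k))                     ∎
    where open ≡-Reasoning

  length-encode-slice : ∀ s m Y → s + m ≤ length Y → length (encode (slice s m Y)) ≡ m
  length-encode-slice s m Y s+m≤ = trans (length-encode (slice s m Y)) (length-slice s m Y s+m≤)

  slice-≋⇔ : ∀ s t m Y → s + m ≤ length Y → t + m ≤ length Y →
             slice s m Y ≋ slice t m Y ⇔
             (∀ k → k < m → clip k (encode Y ! (s + k)) ≡ clip k (encode Y ! (t + k)))
  slice-≋⇔ s t m Y s+m≤ t+m≤ = mk⇔
    (λ ≋ k k<m → trans (sym (!-encode-slice s m Y k<m))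
                       (trans (cong (_! k) (Equivalence.to ≋⇔≡ ≋)) (!-encode-slice t m Y k<m)))
    (λ pt → Equivalence.from ≋⇔≡ (!-ext _ _
      (trans (length-encode-slice s m Y s+m≤) (sym (length-encode-slice t m Y t+m≤)))
      (λ k k< → let k<m = subst (k <_) (length-encode-slice s m Y s+m≤) k< in
        trans (!-encode-slice s m Y k<m) (trans (pt k k<m) (sym (!-encode-slice t m Y k<m))))))

  -- Entries k ≥ 1 of an anchored encoding are nonzero and survive clipping,
  -- so agreement of clipped entries is plain equality.
  border⇔periodic : ∀ {Y q} → Anchored (encode Y) → q ≤ length Y →
                    take (length Y ∸ q) Y ≋ drop q Y ⇔ Periodic (shifted (encode Y)) (pred (length Y)) q
  border⇔periodic {Y} {q} anchored q≤ℓ =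
    subst (λ Z → take (ℓ ∸ q) Y ≋ Z ⇔ Periodic (shifted W) (pred ℓ) q) (slice-suffix q Y) (mk⇔
      (λ ≋ → to (Equivalence.to (slice-≋⇔ 0 q (ℓ ∸ q) Y (m∸n≤m ℓ q) q+[ℓ∸q]≤ℓ) ≋))
      (λ per → Equivalence.from (slice-≋⇔ 0 q (ℓ ∸ q) Y (m∸n≤m ℓ q) q+[ℓ∸q]≤ℓ) (from per)))
    where
    ℓ = length Y
    W = encode Y
    q+[ℓ∸q]≤ℓ = ≤-reflexive (m+[n∸m]≡n q≤ℓ)
    q+suc : ∀ k → q + suc k ≡ suc (k + q)
    q+suc k = trans (+-suc q k) (cong suc (+-comm q k))
    to : (∀ k → k < ℓ ∸ q → clip k (W ! k) ≡ clip k (W ! (q + k))) → Periodic (shifted W) (pred ℓ) q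
    to pt k k+q<ℓ-1 = subst (λ i → W ! i ≡ W ! suc k) (q+suc k) (clip-nonzero W!k≢0 (begin
        clip (suc k) (W ! (q + suc k))  ≡⟨ pt (suc k) (+<⇒<∸ 1+k+q<ℓ) ⟨
        clip (suc k) (W ! suc k)        ≡⟨ clip-≤ (encode-bounded Y (suc k)) ⟩
        W ! suc k                       ∎))
      where
      open ≡-Reasoning
      1+k+q<ℓ = Equivalence.to <pred⇔suc< k+q<ℓ-1
      W!k≢0 = anchored-! anchored (s≤s z≤n)
                (subst (suc k <_) (sym (length-encode Y)) (≤-<-trans (s≤s (m≤m+n k q)) 1+k+q<ℓ))
    from : Periodic (shifted W) (pred ℓ) q → ∀ k → k < ℓ ∸ q → clip k (W ! k) ≡ clip k (W ! (q + k))
    from per zero    _      = trans (clip-zero (W ! 0)) (sym (clip-zero (W ! (q + 0))))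
    from per (suc k) k<ℓ-q = cong (clip (suc k)) (sym (trans (cong (W !_) (q+suc k))
                               (per k (Equivalence.from <pred⇔suc< (<∸⇒+< (suc k) ℓ q k<ℓ-q)))))

  periodic-of-block : ∀ {F p} → AnchoredBlockPeriod F p → Periodic (shifted (encode F)) (pred (length F)) p
  periodic-of-block (anchored , _ , _ , p≤ℓ , border) = Equivalence.to (border⇔periodic anchored p≤ℓ) border

  encode-aligned-slice : ∀ {F p} → AnchoredBlockPeriod F p → ∀ {s m} → p ∣ s → s + m ≤ length F →
                         encode (slice s m F) ≡ take m (encode F)
  encode-aligned-slice {F} {p} block {s} {m} p∣s s+m≤ℓ = !-ext _ _
    (trans (length-encode-slice s m F s+m≤ℓ)
           (sym (length-slice 0 m W (subst (m ≤_) (sym (length-encode F)) (≤-trans (m≤n+m m s) s+m≤ℓ)))))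
    (λ k k< → let k<m = subst (k <_) (length-encode-slice s m F s+m≤ℓ) k< in
      trans (!-encode-slice s m F k<m) (trans (aligned k k<m) (sym (!-take W k<m))))
    where
    W = encode F
    perF = periodic-of-block block
    aligned : ∀ k → k < m → clip k (W ! (s + k)) ≡ W ! k
    aligned zero    _   = trans (clip-zero (W ! (s + 0))) (sym (n≤0⇒n≡0 (encode-bounded F 0)))
    aligned (suc k) k<m = begin
      clip (suc k) (W ! (s + suc k))  ≡⟨ cong (λ i → clip (suc k) (W ! i)) (trans (+-suc s k) (cong suc (+-comm s k))) ⟩
      clip (suc k) (W ! suc (k + s))  ≡⟨ cong (clip (suc k)) (periodic-∣ perF p∣s k k+s<ℓ-1) ⟩
      clip (suc k) (W ! suc k)        ≡⟨ clip-≤ (encode-bounded F (suc k)) ⟩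
      W ! suc k                       ∎
      where
      open ≡-Reasoning
      k+s<ℓ-1 = Equivalence.from <pred⇔suc<
        (<-≤-trans (+-monoˡ-< s k<m) (subst (_≤ length F) (+-comm s m) s+m≤ℓ))

  aligned-slices-≋ : ∀ {F p} → AnchoredBlockPeriod F p → ∀ {s t m} → p ∣ s → p ∣ t →
                     s + m ≤ length F → t + m ≤ length F → slice s m F ≋ slice t m F
  aligned-slices-≋ block p∣s p∣t s+m≤ℓ t+m≤ℓ = Equivalence.from ≋⇔≡
    (trans (encode-aligned-slice block p∣s s+m≤ℓ) (sym (encode-aligned-slice block p∣t t+m≤ℓ)))

  anchored-aligned-slice : ∀ {F p} → AnchoredBlockPeriod F p → ∀ {s m} → p ∣ s → s + m ≤ length F →
                           Anchored (encode (slice s m F))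
  anchored-aligned-slice {F} block@(anchored , _) {m = m} p∣s s+m≤ℓ =
    subst Anchored (sym (encode-aligned-slice block p∣s s+m≤ℓ)) (anchored-take m anchored)

  aligned-slice-border⇔periodic : ∀ {F p} → AnchoredBlockPeriod F p → ∀ {s m q} →
                                  p ∣ s → s + m ≤ length F → q ≤ m →
    let G = slice s m F in take (length G ∸ q) G ≋ drop q G ⇔ Periodic (shifted (encode F)) (pred m) q
  aligned-slice-border⇔periodic {F} block {s} {m} {q} p∣s s+m≤ℓ q≤m = mk⇔
    (λ border → periodic-cong (λ k k< → sym (shiftedG k k<))
                  (subst (λ n → Periodic (shifted (encode G)) (pred n) q) |G|≡m (Equivalence.to border⇔ border)))
    (λ per → Equivalence.from border⇔
               (subst (λ n → Periodic (shifted (encode G)) (pred n) q) (sym |G|≡m) (periodic-cong shiftedG per)))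
    where
    G = slice s m F
    W = encode F
    |G|≡m = length-slice s m F s+m≤ℓ
    border⇔ = border⇔periodic (anchored-aligned-slice block p∣s s+m≤ℓ) (subst (q ≤_) (sym |G|≡m) q≤m)
    shiftedG : ∀ k → k < pred m → shifted W k ≡ shifted (encode G) k
    shiftedG k k< = trans (sym (!-take {m} W (Equivalence.to <pred⇔suc< k<)))
                          (cong (_! suc k) (sym (encode-aligned-slice block p∣s s+m≤ℓ)))

  -- A shorter border period q of the slice would make gcd p q a period of all
  -- of F (Fine–Wilf inside the slice, whose length is ≥ 2p > p + q).
  aligned-slice-border-minimal : ∀ {F p} → MinAnchoredBlockPeriod F p → ∀ {s m} →
                                 p ∣ s → s + m ≤ length F → 2 * p ≤ m →
                                 ∀ q → BorderPeriod (slice s m F) q → p ≤ q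
  aligned-slice-border-minimal {F} {p} (blockF@(anchoredF , p∣ℓ , 1≤p , _) , minimalF) {s} {m} p∣s s+m≤ℓ 2p≤m
                               q (1≤q , q≤|G| , borderG) with p ≤? q
  ... | yes p≤q = p≤q
  ... | no  p≰q = ⊥-elim (<-irrefl refl (≤-<-trans (≤-trans p≤g g≤q) q<p))
    where
    perF = periodic-of-block blockF
    q<p = ≰⇒> p≰q
    m≤ℓ = ≤-trans (m≤n+m m s) s+m≤ℓ
    q≤m = subst (q ≤_) (length-slice s m F s+m≤ℓ) q≤|G|
    p+q≤m-1 = <⇒≤pred (<-≤-trans (+-monoʳ-< p q<p) (subst (λ n → p + n ≤ m) (+-identityʳ p) 2p≤m))
    g = gcd p q
    g≤q = gcd[m,n]≤n p q ⦃ >-nonZero 1≤q ⦄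
    g≤ℓ = ≤-trans g≤q (≤-trans q≤m m≤ℓ)
    1≤g = n≢0⇒n>0 (gcd[m,n]≢0 p q (inj₁ (>⇒≢ 1≤p)))
    per-g = periodic-extend ⦃ >-nonZero 1≤p ⦄ perF
              (periodic-gcd p+q≤m-1 (periodic-restrict (pred-mono-≤ m≤ℓ) perF)
                                    (Equivalence.to (aligned-slice-border⇔periodic blockF p∣s s+m≤ℓ q≤m) borderG))
              (≤-trans (+-monoʳ-≤ p g≤q) p+q≤m-1)
    p≤g = minimalF g (∣-trans (gcd[m,n]∣m p q) p∣ℓ)
            (1≤g , g≤ℓ , Equivalence.from (border⇔periodic anchoredF g≤ℓ) per-g)

  slice-minAnchoredBlockPeriod : ∀ {F p} → MinAnchoredBlockPeriod F p → ∀ {s m} → p ∣ s → p ∣ m →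
                                 s + m ≤ length F → 2 * p ≤ m → MinAnchoredBlockPeriod (slice s m F) p
  slice-minAnchoredBlockPeriod {F} {p} min@(blockF@(_ , _ , 1≤p , _) , _) {s} {m} p∣s p∣m s+m≤ℓ 2p≤m =
    (anchored-aligned-slice blockF p∣s s+m≤ℓ , subst (p ∣_) (sym |G|≡m) p∣m ,
     1≤p , subst (p ≤_) (sym |G|≡m) p≤m ,
     Equivalence.from (aligned-slice-border⇔periodic blockF p∣s s+m≤ℓ p≤m)
                      (periodic-restrict (pred-mono-≤ (≤-trans (m≤n+m m s) s+m≤ℓ)) (periodic-of-block blockF))) ,
    λ q _ → aligned-slice-border-minimal min p∣s s+m≤ℓ 2p≤m q
    where
    |G|≡m = length-slice s m F s+m≤ℓ
    p≤m = ≤-trans (m≤m+n p (p + 0)) 2p≤m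

module CartesianTrees {a ℓ₁ ℓ₂ : Level} (O : StrictTotalOrder a ℓ₁ ℓ₂) where

  open StrictTotalOrder O
    using (compare; <-respˡ-≈)
    renaming (Carrier to A; _<_ to _≺_; _<?_ to _≺?_; trans to ≺-trans)
  open CT O

  ⊀-trans : ∀ {x y z} → ¬ x ≺ y → ¬ y ≺ z → ¬ x ≺ z
  ⊀-trans {x} {y} x⊀y y⊀z x≺z with compare x y
  ... | tri< x≺y _ _ = x⊀y x≺y
  ... | tri≈ _ x≈y _ = y⊀z (<-respˡ-≈ x≈y x≺z)
  ... | tri> _ _ y≺x = y⊀z (≺-trans y≺x x≺z)

  lmSplit-spec : ∀ x xs {pre m suf} → lmSplit x xs ≡ (pre , m , suf) →
                 (x ∷ xs ≡ pre ++ m ∷ suf) × All (m ≺_) pre × All (λ y → ¬ y ≺ m) suf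
  lmSplit-spec x []       refl = refl , [] , []
  lmSplit-spec x (y ∷ ys) eq with lmSplit y ys in eq′
  ... | pre , m , suf with m ≺? x | lmSplit-spec y ys eq′
  ...   | yes m≺x | ys≡ , m≺pre , m⊀suf with refl ← eq = cong (x ∷_) ys≡ , m≺x ∷ m≺pre , m⊀suf
  ...   | no  m⊀x | ys≡ , m≺pre , m⊀suf with refl ← eq =
    refl , [] , subst (All (λ z → ¬ z ≺ x)) (sym ys≡)
      (++⁺ (All.map (λ m≺z z≺x → m⊀x (≺-trans m≺z z≺x)) m≺pre)
           (m⊀x ∷ All.map (λ z⊀m → ⊀-trans z⊀m m⊀x) m⊀suf))

  lmSplit-length : ∀ x xs {pre m suf} → lmSplit x xs ≡ (pre , m , suf) → length xs ≡ length pre + length suf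
  lmSplit-length x xs {pre} {m} {suf} eq = suc-injective (begin
    length (x ∷ xs)               ≡⟨ cong length (proj₁ (lmSplit-spec x xs eq)) ⟩
    length (pre ++ m ∷ suf)       ≡⟨ length-++ pre ⟩
    length pre + suc (length suf) ≡⟨ +-suc (length pre) (length suf) ⟩
    suc (length pre + length suf) ∎)
    where open ≡-Reasoning

  module NonStrict = ParentDistance {R = λ y x → ¬ x ≺ y} (λ y x → ¬? (x ≺? y))
  module Strict    = ParentDistance _≺?_

  NonStrict-encode-lmSplit : ∀ x xs {pre m suf} → lmSplit x xs ≡ (pre , m , suf) →
    NonStrict.encode (x ∷ xs) ≡ NonStrict.encode pre ++ 0 ∷ attach 0 (NonStrict.encode suf)
  NonStrict-encode-lmSplit x xs eq with xs≡ , m≺pre , m⊀suf ← lmSplit-spec x xs eq =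
    trans (cong NonStrict.encode xs≡) (NonStrict.encode-split (All.map (λ m≺y y⊀m → y⊀m m≺y) m≺pre) m⊀suf)

  Strict-encode-lmSplit : ∀ x xs {pre m suf} → lmSplit x xs ≡ (pre , m , suf) →
    Strict.encode (reverse (x ∷ xs)) ≡ Strict.encode (reverse suf) ++ 0 ∷ attach 0 (Strict.encode (reverse pre))
  Strict-encode-lmSplit x xs {pre} {m} {suf} eq with xs≡ , m≺pre , m⊀suf ← lmSplit-spec x xs eq =
    trans (cong (Strict.encode ∘ reverse) xs≡)
          (trans (cong Strict.encode (reverse-++-∷ pre m suf))
                 (Strict.encode-split (All-ʳ++ m⊀suf []) (All-ʳ++ m≺pre [])))

  private
    shorter : ∀ {n} x xs {pre m suf} → lmSplit x xs ≡ (pre , m , suf) → length (x ∷ xs) ≤ suc n →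
              length pre ≤ n × length suf ≤ n
    shorter {n} x xs {pre} {m} {suf} eq |Y|≤ =
      ≤-trans (m≤m+n (length pre) (length suf)) |pre|+|suf|≤n ,
      ≤-trans (m≤n+m (length suf) (length pre)) |pre|+|suf|≤n
      where
      |pre|+|suf|≤n = subst (_≤ n) (lmSplit-length x xs eq) (s≤s⁻¹ |Y|≤)

  NonStrict-encode≡serialise : ∀ n Y → length Y ≤ n → NonStrict.encode Y ≡ serialise (ctF n Y)
  NonStrict-encode≡serialise zero    []       _   = refl
  NonStrict-encode≡serialise (suc n) []       _   = refl
  NonStrict-encode≡serialise (suc n) (x ∷ xs) |Y|≤ with lmSplit x xs in eq
  ... | pre , m , suf with |pre|≤ , |suf|≤ ← shorter x xs eq |Y|≤ =
    trans (NonStrict-encode-lmSplit x xs eq)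
          (cong₂ (λ U V → U ++ 0 ∷ attach 0 V) (NonStrict-encode≡serialise n pre |pre|≤)
                                                (NonStrict-encode≡serialise n suf |suf|≤))

  Strict-encode≡serialise : ∀ n Y → length Y ≤ n → Strict.encode (reverse Y) ≡ serialise (mirror (ctF n Y))
  Strict-encode≡serialise zero    []       _   = refl
  Strict-encode≡serialise (suc n) []       _   = refl
  Strict-encode≡serialise (suc n) (x ∷ xs) |Y|≤ with lmSplit x xs in eq
  ... | pre , m , suf with |pre|≤ , |suf|≤ ← shorter x xs eq |Y|≤ =
    trans (Strict-encode-lmSplit x xs eq)
          (cong₂ (λ U V → U ++ 0 ∷ attach 0 V) (Strict-encode≡serialise n suf |suf|≤)
                                                (Strict-encode≡serialise n pre |pre|≤))

  NonStrict-bridge : ∀ Y → NonStrict.encode Y ≡ serialise (CTree Y)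
  NonStrict-bridge Y = NonStrict-encode≡serialise (length Y) Y ≤-refl

  Strict-bridge : ∀ T → Strict.encode T ≡ serialise (mirror (CTree (reverse T)))
  Strict-bridge T = trans (cong Strict.encode (sym (reverse-involutive T)))
                          (Strict-encode≡serialise (length (reverse T)) (reverse T) ≤-refl)

  ≈CT⇔NonStrict : ∀ {Y Y′} → Y ≈CT Y′ ⇔ NonStrict.encode Y ≡ NonStrict.encode Y′
  ≈CT⇔NonStrict {Y} {Y′} = mk⇔
    (λ eq → trans (NonStrict-bridge Y) (trans (cong serialise eq) (sym (NonStrict-bridge Y′))))
    (λ eq → serialise-injective _ _ (trans (sym (NonStrict-bridge Y)) (trans eq (NonStrict-bridge Y′))))

  reverse-≈CT⇔Strict : ∀ {T T′} → reverse T ≈CT reverse T′ ⇔ Strict.encode T ≡ Strict.encode T′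
  reverse-≈CT⇔Strict {T} {T′} = mk⇔
    (λ eq → trans (Strict-bridge T) (trans (cong (serialise ∘ mirror) eq) (sym (Strict-bridge T′))))
    (λ eq → begin
      CT₁                    ≡⟨ mirror-involutive CT₁ ⟨
      mirror (mirror CT₁)    ≡⟨ cong mirror (serialise-injective _ _
                                  (trans (sym (Strict-bridge T)) (trans eq (Strict-bridge T′)))) ⟩
      mirror (mirror CT₂)    ≡⟨ mirror-involutive CT₂ ⟩
      CT₂                    ∎)
    where
    open ≡-Reasoning
    CT₁ = CTree (reverse T)
    CT₂ = CTree (reverse T′)

  NonStrict-encode-bounded : ∀ Y k → NonStrict.encode Y ! k ≤ k
  NonStrict-encode-bounded Y k = subst (λ W → W ! k ≤ k) (sym (NonStrict-bridge Y))
    (!-bounded (serialise (CTree Y)) k (serialise-bounded (CTree Y)))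

  Strict-encode-bounded : ∀ T k → Strict.encode T ! k ≤ k
  Strict-encode-bounded T k = subst (λ W → W ! k ≤ k) (sym (Strict-bridge T))
    (!-bounded (serialise (mirror (CTree (reverse T)))) k (serialise-bounded (mirror (CTree (reverse T)))))

  lmPos≡1⇔anchored : ∀ x xs → lmPos (x ∷ xs) ≡ 1 ⇔ Anchored (NonStrict.encode (x ∷ xs))
  lmPos≡1⇔anchored x xs with lmSplit x xs in eq
  ... | pre , m , suf = mk⇔
    (λ lm≡1 → subst Anchored (sym split) (Equivalence.from anchored⇔
                 (trans (NonStrict.length-encodeFrom [] pre) (suc-injective lm≡1))))
    (λ anchored → cong suc (trans (sym (NonStrict.length-encodeFrom [] pre))
                                  (Equivalence.to anchored⇔ (subst Anchored split anchored))))
    where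
    split = NonStrict-encode-lmSplit x xs eq
    anchored⇔ = anchored-split⇔ (NonStrict.encode pre) (NonStrict.encode suf)

  lmPos≡length⇔anchored : ∀ Y → lmPos Y ≡ length Y ⇔ Anchored (Strict.encode (reverse Y))
  lmPos≡length⇔anchored []       = mk⇔ (λ _ → tt) (λ _ → refl)
  lmPos≡length⇔anchored (x ∷ xs) with lmSplit x xs in eq
  ... | pre , m , suf = mk⇔
    (λ lm≡len → subst Anchored (sym split) (Equivalence.from anchored⇔ (trans |encode-suf| (|suf|≡0 lm≡len))))
    (λ anchored → lm≡len (trans (sym |encode-suf|) (Equivalence.to anchored⇔ (subst Anchored split anchored))))
    where
    split = Strict-encode-lmSplit x xs eq
    anchored⇔ = anchored-split⇔ (Strict.encode (reverse suf)) (Strict.encode (reverse pre))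
    |encode-suf| : length (Strict.encode (reverse suf)) ≡ length suf
    |encode-suf| = trans (Strict.length-encodeFrom [] (reverse suf)) (length-reverse suf)
    |xs| = lmSplit-length x xs eq
    |suf|≡0 : suc (length pre) ≡ suc (length xs) → length suf ≡ 0
    |suf|≡0 eq′ = sym (+-cancelˡ-≡ (length pre) 0 (length suf)
                        (trans (+-identityʳ (length pre)) (trans (suc-injective eq′) |xs|)))
    lm≡len : length suf ≡ 0 → suc (length pre) ≡ suc (length xs)
    lm≡len |suf|≡0 = cong suc (sym (trans |xs| (trans (cong (length pre +_) |suf|≡0) (+-identityʳ (length pre)))))

module BlockPeriodicSlices {a ℓ₁ ℓ₂ : Level} (O : StrictTotalOrder a ℓ₁ ℓ₂) where

  open CT O
  open CartesianTrees O

  module Left = AnchoredPeriods _≈CT_ NonStrict.encode ≈CT⇔NonStrict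
    (NonStrict.length-encodeFrom []) NonStrict-encode-bounded NonStrict.encode-slice

  -- Reversal puts a leftmost minimum at the end first, and makes it strict.
  module Right = AnchoredPeriods (λ T T′ → reverse T ≈CT reverse T′) Strict.encode reverse-≈CT⇔Strict
    (Strict.length-encodeFrom []) Strict-encode-bounded Strict.encode-slice

  minCTBlock⇒Left : ∀ {F p} → MinCTBlockPeriod F p → lmPos F ≡ 1 → Left.MinAnchoredBlockPeriod F p
  minCTBlock⇒Left {x ∷ xs} ((p∣ℓ , border , _) , minimal) lm≡1 =
    (Equivalence.to (lmPos≡1⇔anchored x xs) lm≡1 , p∣ℓ , border) ,
    λ q q∣ℓ border-q → minimal q (q∣ℓ , border-q , inj₁ lm≡1)

  Left⇒minCTBlock : ∀ {G p} → Left.MinAnchoredBlockPeriod G p → MinCTBlockPeriod G p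
  Left⇒minCTBlock {[]}     ((_ , _ , 1≤p , p≤0 , _) , _) with () ← ≤-trans 1≤p p≤0
  Left⇒minCTBlock {x ∷ xs} ((anchored , p∣ℓ , border) , minimal) =
    (p∣ℓ , border , inj₁ (Equivalence.from (lmPos≡1⇔anchored x xs) anchored)) ,
    λ { q (q∣ℓ , border-q , _) → minimal q q∣ℓ border-q }

  reverse-border⇔ : ∀ {Y q} → CTBorderPeriod Y q ⇔ Right.BorderPeriod (reverse Y) q
  reverse-border⇔ {Y} {q} = mk⇔
    (λ (1≤q , q≤ℓ , border) → 1≤q , subst (q ≤_) (sym |rY|) q≤ℓ ,
        subst₂ _≈CT_ (sym (reverse-suffix q≤ℓ)) (sym (reverse-prefix q≤ℓ)) (sym border))
    (λ (1≤q , q≤|rY| , border) → let q≤ℓ = subst (q ≤_) |rY| q≤|rY| in 1≤q , q≤ℓ ,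
        sym (subst₂ _≈CT_ (reverse-suffix q≤ℓ) (reverse-prefix q≤ℓ) border))
    where
    ℓ = length Y
    |rY| = length-reverse Y
    reverse-suffix : q ≤ ℓ → reverse (take (length (reverse Y) ∸ q) (reverse Y)) ≡ drop q Y
    reverse-suffix _ = begin
      reverse (take (length (reverse Y) ∸ q) (reverse Y))  ≡⟨ cong (λ n → reverse (take (n ∸ q) (reverse Y))) |rY| ⟩
      reverse (take (ℓ ∸ q) (reverse Y))                   ≡⟨ cong reverse (reverse-drop q Y) ⟨
      reverse (reverse (drop q Y))                         ≡⟨ reverse-involutive (drop q Y) ⟩
      drop q Y                                             ∎
      where open ≡-Reasoning
    reverse-prefix : q ≤ ℓ → reverse (drop q (reverse Y)) ≡ take (ℓ ∸ q) Y
    reverse-prefix q≤ℓ = begin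
      reverse (drop q (reverse Y))                ≡⟨ cong (λ n → reverse (drop n (reverse Y))) (m∸[m∸n]≡n q≤ℓ) ⟨
      reverse (drop (ℓ ∸ (ℓ ∸ q)) (reverse Y))    ≡⟨ cong reverse (reverse-take (ℓ ∸ q) Y) ⟨
      reverse (reverse (take (ℓ ∸ q) Y))          ≡⟨ reverse-involutive (take (ℓ ∸ q) Y) ⟩
      take (ℓ ∸ q) Y                              ∎
      where open ≡-Reasoning

  minCTBlock⇒Right : ∀ {F p} → MinCTBlockPeriod F p → lmPos F ≡ length F →
                     Right.MinAnchoredBlockPeriod (reverse F) p
  minCTBlock⇒Right {F} {p} ((p∣ℓ , border , _) , minimal) lm≡ℓ =
    (Equivalence.to (lmPos≡length⇔anchored F) lm≡ℓ , subst (p ∣_) (sym (length-reverse F)) p∣ℓ ,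
     Equivalence.to reverse-border⇔ border) ,
    λ q q∣ℓ border-q →
      minimal q (subst (q ∣_) (length-reverse F) q∣ℓ , Equivalence.from reverse-border⇔ border-q , inj₂ lm≡ℓ)

  Right⇒minCTBlock : ∀ {G p} → Right.MinAnchoredBlockPeriod (reverse G) p → MinCTBlockPeriod G p
  Right⇒minCTBlock {G} {p} ((anchored , p∣ℓ , border) , minimal) =
    (subst (p ∣_) (length-reverse G) p∣ℓ , Equivalence.from reverse-border⇔ border ,
     inj₂ (Equivalence.from (lmPos≡length⇔anchored G) anchored)) ,
    λ { q (q∣ℓ , border-q , _) →
          minimal q (subst (q ∣_) (sym (length-reverse G)) q∣ℓ) (Equivalence.to reverse-border⇔ border-q) }

  slice-minCTBlockPeriod : ∀ {F p s m} → MinCTBlockPeriod F p →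
                           p ∣ s → p ∣ m → s + m ≤ length F → 2 * p ≤ m →
                           (slice s m F ≈CT take m F) × MinCTBlockPeriod (slice s m F) p
  slice-minCTBlockPeriod {F} {p} {s} {m} min@((_ , _ , inj₁ lm≡1) , _) p∣s p∣m s+m≤ℓ 2p≤m =
    Left.aligned-slices-≋ (proj₁ minL) p∣s (p ∣0) s+m≤ℓ (≤-trans (m≤n+m m s) s+m≤ℓ) ,
    Left⇒minCTBlock (Left.slice-minAnchoredBlockPeriod minL p∣s p∣m s+m≤ℓ 2p≤m)
    where
    minL = minCTBlock⇒Left min lm≡1
  slice-minCTBlockPeriod {F} {p} {s} {m} min@((p∣ℓ , _ , inj₂ lm≡ℓ) , _) p∣s p∣m s+m≤ℓ 2p≤m =
    subst₂ _≈CT_ (unreverse s+m≤ℓ) (unreverse m≤ℓ)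
      (Right.aligned-slices-≋ (proj₁ minR) (p∣mirrored p∣s s+m≤ℓ) (p∣mirrored (p ∣0) m≤ℓ)
                              (mirrored-bound s+m≤ℓ) (mirrored-bound m≤ℓ)) ,
    Right⇒minCTBlock (subst (λ T → Right.MinAnchoredBlockPeriod T p) (sym (reverse-slice s m F s+m≤ℓ))
      (Right.slice-minAnchoredBlockPeriod minR (p∣mirrored p∣s s+m≤ℓ) p∣m (mirrored-bound s+m≤ℓ) 2p≤m))
    where
    ℓ = length F
    minR = minCTBlock⇒Right min lm≡ℓ
    m≤ℓ = ≤-trans (m≤n+m m s) s+m≤ℓ
    p∣mirrored : ∀ {t} → p ∣ t → t + m ≤ ℓ → p ∣ ℓ ∸ (t + m)
    p∣mirrored p∣t t+m≤ℓ = ∣m∣n⇒∣m∸n p∣ℓ (∣m∣n⇒∣m+n p∣t p∣m) t+m≤ℓ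
    mirrored-bound : ∀ {t} → t + m ≤ ℓ → ℓ ∸ (t + m) + m ≤ length (reverse F)
    mirrored-bound {t} t+m≤ℓ = subst (ℓ ∸ (t + m) + m ≤_) (sym (length-reverse F))
      (≤-trans (+-monoʳ-≤ (ℓ ∸ (t + m)) (m≤n+m m t)) (≤-reflexive (m∸n+n≡m t+m≤ℓ)))
    unreverse : ∀ {t} → t + m ≤ ℓ → reverse (slice (ℓ ∸ (t + m)) m (reverse F)) ≡ slice t m F
    unreverse {t} t+m≤ℓ = trans (cong reverse (sym (reverse-slice t m F t+m≤ℓ))) (reverse-involutive (slice t m F))

  length-frag : ∀ X {i j} → 1 ≤ i → i ≤ j → j ≤ length X + 1 → length (frag X i j) ≡ j ∸ i
  length-frag X {i} {j} 1≤i i≤j j≤ = length-slice (i ∸ 1) (j ∸ i) X (begin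
    i ∸ 1 + (j ∸ i)  ≡⟨ telescope 1≤i i≤j ⟩
    j ∸ 1            ≤⟨ ∸-monoˡ-≤ 1 j≤ ⟩
    length X + 1 ∸ 1 ≡⟨ m+n∸n≡m (length X) 1 ⟩
    length X         ∎)
    where open ≤-Reasoning

  frag-frag : ∀ X {i j a b} → 1 ≤ i → i ≤ a → a ≤ b → b ≤ j →
              frag X a b ≡ slice (a ∸ i) (b ∸ a) (frag X i j)
  frag-frag X {i} {j} {a} {b} 1≤i i≤a a≤b b≤j = sym (trans
    (slice-slice (i ∸ 1) (j ∸ i) (a ∸ i) (b ∸ a) X
                 (subst (_≤ j ∸ i) (sym (telescope i≤a a≤b)) (∸-monoˡ-≤ i b≤j)))
    (cong (λ r → slice r (b ∸ a) X) (telescope 1≤i i≤a)))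

lemma19 : {a ℓ₁ ℓ₂ : Level} (O : StrictTotalOrder a ℓ₁ ℓ₂) →
    let open CT O in
    (X : List (StrictTotalOrder.Carrier O)) (i j p : ℕ) →
    1 ≤ i → i ≤ j → j ≤ length X + 1 →
    MinCTBlockPeriod (frag X i j) p →
    (a b : ℕ) → i ≤ a → a ≤ j → i ≤ b → b ≤ j →
    p ∣ (a ∸ i) → p ∣ (j ∸ b) → 2 * p ≤ b ∸ a →
    (frag X a b ≈CT frag X i (i + (b ∸ a))) × MinCTBlockPeriod (frag X a b) p
-- The hypothesis i ≤ b is implied by i ≤ a ≤ b.
lemma19 O X i j p 1≤i i≤j j≤ min@((p∣ℓ , (1≤p , _) , _) , _) a b i≤a a≤j _ b≤j p∣a∸i p∣j∸b 2p≤m =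
  subst₂ (λ U V → (U ≈CT V) × MinCTBlockPeriod U p)
    (sym (frag-frag X 1≤i i≤a a≤b b≤j)) (sym prefix)
    (slice-minCTBlockPeriod min p∣a∸i p∣m s+m≤ 2p≤m)
  where
  open CT O
  open BlockPeriodicSlices O
  m = b ∸ a
  a≤b = <⇒≤ (m∸n≢0⇒n<m (>⇒≢ (≤-trans 1≤p (≤-trans (m≤m+n p (p + 0)) 2p≤m))))
  |F|≡ = length-frag X 1≤i i≤j j≤
  j∸i≡ : j ∸ i ≡ (a ∸ i) + ((j ∸ b) + m)
  j∸i≡ = sym (trans (cong (a ∸ i +_) (trans (+-comm (j ∸ b) m) (telescope a≤b b≤j))) (telescope i≤a a≤j))
  s+m≤ = subst (a ∸ i + m ≤_) (sym (trans |F|≡ j∸i≡)) (+-monoʳ-≤ (a ∸ i) (m≤n+m m (j ∸ b)))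
  p∣m = ∣m+n∣m⇒∣n (∣m+n∣m⇒∣n (subst (p ∣_) (trans |F|≡ j∸i≡) p∣ℓ) p∣a∸i) p∣j∸b
  prefix : frag X i (i + m) ≡ take m (frag X i j)
  prefix = trans (frag-frag X 1≤i ≤-refl (m≤m+n i m) i+m≤j)
                 (cong₂ (λ r n → slice r n (frag X i j)) (n∸n≡0 i) (m+n∸m≡n i m))
    where
    i+m≤j = ≤-trans (+-monoˡ-≤ m i≤a) (≤-trans (≤-reflexive (m+[n∸m]≡n a≤b)) b≤j)
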